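{- Let $S\subseteq\Sigma^c$ be a set of $n$ keys, let $p\subseteq[c]\times\Sigma$ be a generalized key, and let $t\ge1$. Then the number of $2t$-tuples $(x_1,\dots,x_{2t})\in S^{2t}$ such that $\Delta_{i\in[2t]}x_i=p$ is at most $((2t-1)!!)^c\,n^t$.
   Context: Each key $x=x_1\cdots x_c\in\Sigma^c$ is identified with its set of position characters $\{(1,x_1),\dots,(c,x_c)\}\subseteq[c]\times\Sigma$. A generalized key is any subset of $[c]\times\Sigma$. $\Delta_{i}x_i$ denotes the symmetric difference of the sets $x_i$, i.e. the set of position characters occurring an odd number of times among $x_1,\dots,x_{2t}$. $(2t-1)!!=(2t-1)(2t-3)\cdots1$. -}

module Defs where

open import Data.Nat using (ℕ; zero; suc; _*_)
open import Data.Bool using (Bool; true; false; _xor_)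
open import Data.Fin using (Fin)
open import Data.Fin.Properties using (_≟_; all?)
open import Data.Vec using (Vec; []; _∷_; lookup)
open import Data.List using (List; []; _∷_; map; concatMap; filter; length)
open import Relation.Binary.PropositionalEquality using (_≡_)
open import Relation.Nullary using (does; Dec)
open import Data.Bool.Properties renaming (_≟_ to _≟ᵇ_)

Key : ℕ → ℕ → Set
Key c σ = Vec (Fin σ) c

-- A generalized key: a subset of [c] × Σ, given by its characteristic function.
GenKey : ℕ → ℕ → Set
GenKey c σ = Fin c → Fin σ → Bool

asSet : ∀ {c σ} → Key c σ → GenKey c σ
asSet x i a = does (lookup x i ≟ a)

symDiff : ∀ {c σ m} → Vec (Key c σ) m → GenKey c σ
symDiff []       i a = false
symDiff (x ∷ xs) i a = asSet x i a xor symDiff xs i a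

_≐_ : ∀ {c σ} → GenKey c σ → GenKey c σ → Set
q ≐ p = ∀ i a → q i a ≡ p i a

_≐?_ : ∀ {c σ} (q p : GenKey c σ) → Dec (q ≐ p)
q ≐? p = all? (λ i → all? (λ a → q i a ≟ᵇ p i a))

tuples : ∀ {A : Set} → List A → (m : ℕ) → List (Vec A m)
tuples S zero    = [] ∷ []
tuples S (suc m) = concatMap (λ x → map (x ∷_) (tuples S m)) S

countTuples : ∀ {c σ} → List (Key c σ) → GenKey c σ → (t : ℕ) → ℕ
countTuples S p t = length (filter (λ xs → symDiff xs ≐? p) (tuples S (2 * t)))

-- Double factorial of an odd number: dfOdd t = (2t-1)!! = (2t-1)(2t-3)⋯1.
dfOdd : ℕ → ℕ
dfOdd zero    = 1
dfOdd (suc t) = (suc (2 * t)) * dfOdd t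

-- Split a 2t-tuple into two t-tuples u, v. If m(q) counts the t-tuples u with Δu = q, the
-- number of solutions of Δ = p is ∑_q m(q) m(q ⊕ p); as q ↦ q ⊕ p is a permutation,
-- Cauchy–Schwarz bounds this by ∑_q m(q)², the number of solutions of Δ = ∅.
-- For Δ = ∅ we show by induction on c that the number N of tuples in T₁ × ⋯ × T_m with empty
-- symmetric difference satisfies N² ≤ ((m − 1)!!)^(2c) ∏ᵢ |Tᵢ| whenever every Tᵢ consists of
-- distinct keys. Splitting keys into first character and rest, the first characters of a
-- solution form a word in which every letter occurs an even number of times. Its first letter
-- is paired with one of the m − 1 later positions, and Cauchy–Schwarz, over the paired letter
-- and over these positions, costs the factor (m − 1)². Bounding N² rather than N, for
-- arbitrary lists Tᵢ, is what makes the induction go through.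
{-# OPTIONS --safe #-}
module Submission where

open import Defs
open import Data.Nat using (ℕ; _≤_; _*_; _^_)
open import Data.List using (List; length)
open import Data.List.Relation.Unary.Unique.Propositional using (Unique)

open import Data.Bool.Base using (Bool; true; false; not; _xor_)
open import Data.Bool.Properties
  using (not-involutive; xor-assoc; xor-comm; xor-same; xor-inverseˡ; xor-identityʳ)
  renaming (_≟_ to _≟ᵇ_)
open import Data.Empty using (⊥-elim)
open import Data.Fin.Base using (Fin; zero; suc)
open import Data.Fin.Properties using (_≟_; all?; ≡-decSetoid)
open import Data.List.Base using ([]; _∷_; map; concatMap; filter; allFin; deduplicate)
  renaming (_++_ to _++ₗ_)
open import Data.List.Properties using (map-++; map-∘; map-cong; map-cong-local; length-tabulate)
open import Data.List.Membership.Propositional using (_∈_)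
open import Data.List.Membership.Propositional.Properties using (∈-allFin)
open import Data.List.Relation.Unary.All as All using (All; []; _∷_)
open import Data.List.Relation.Unary.AllPairs using ([]; _∷_)
open import Data.List.Relation.Unary.Any as Any using (Any; here; there)
import Data.List.Relation.Unary.Any.Properties as Any
import Data.List.Relation.Unary.Unique.Setoid as SetoidUnique
open import Data.List.Relation.Unary.Unique.DecSetoid.Properties using (deduplicate-!)
open import Data.List.Relation.Unary.Unique.Propositional.Properties using (allFin⁺)
open import Data.Nat.Base using (zero; suc; _+_; z≤n; s≤s)
open import Data.Nat.ListAction using (sum)
open import Data.Nat.ListAction.Properties using (sum-++)
open import Data.Nat.Properties
  using ( module ≤-Reasoning; _≤?_; ≤-trans; ≤-reflexive; ≤-total; <⇒≱; ≰⇒>; m≤m+n; m≤n+m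
        ; m≤n⇒∃[o]m+o≡n; +-mono-≤; *-mono-≤; *-mono-<; *-monoˡ-≤; *-monoʳ-≤; +-comm; +-suc
        ; +-identityʳ; *-comm; *-assoc; *-identityˡ; *-zeroʳ; *-distribˡ-+; ^-distribˡ-+-*)
open import Data.Nat.Tactic.RingSolver using (solve-∀)
open import Data.Product.Base using (∃; _×_; _,_)
open import Data.Sum.Base using (inj₁; inj₂)
open import Data.Vec.Base using (Vec; []; _∷_; _++_; lookup; replicate; zipWith; insertAt; removeAt)
open import Data.Vec.Properties using (removeAt-insertAt; insertAt-removeAt)
open import Data.Vec.Relation.Unary.All as Vec using ([]; _∷_)
open import Function.Base using (_∘_)
open import Level using (Level; 0ℓ)
open import Relation.Binary.Bundles using (DecSetoid)
open import Relation.Binary.PropositionalEquality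
  using (_≡_; refl; sym; trans; cong; cong₂; subst; subst₂; module ≡-Reasoning)
open import Relation.Nullary using (Dec; does; yes; no; ¬_)
open import Relation.Nullary.Decidable using (_×-dec_; dec-true)

private
  variable
    a b p q : Level
    A : Set a
    P : Set p
    c m n k σ : ℕ

∑ : {A : Set a} → List A → (A → ℕ) → ℕ
∑ xs f = sum (map f xs)

syntax ∑ xs (λ x → e) = ∑[ x ∈ xs ] e

module _ {A : Set a} where

  ∑-++ : ∀ (xs ys : List A) f → ∑ (xs ++ₗ ys) f ≡ ∑ xs f + ∑ ys f
  ∑-++ xs ys f = trans (cong sum (map-++ f xs ys)) (sum-++ (map f xs) (map f ys))

  ∑-cong : ∀ (xs : List A) {f g} → (∀ x → f x ≡ g x) → ∑ xs f ≡ ∑ xs g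
  ∑-cong xs f≗g = cong sum (map-cong f≗g xs)

  ∑-cong-local : ∀ {xs : List A} {f g} → All (λ x → f x ≡ g x) xs → ∑ xs f ≡ ∑ xs g
  ∑-cong-local eqs = cong sum (map-cong-local eqs)

  ∑-mono : ∀ (xs : List A) {f g} → (∀ x → f x ≤ g x) → ∑ xs f ≤ ∑ xs g
  ∑-mono []       f≤g = z≤n
  ∑-mono (x ∷ xs) f≤g = +-mono-≤ (f≤g x) (∑-mono xs f≤g)

  ∑-+ : ∀ (xs : List A) f g → ∑[ x ∈ xs ] (f x + g x) ≡ ∑ xs f + ∑ xs g
  ∑-+ []       f g = refl
  ∑-+ (x ∷ xs) f g = trans (cong (f x + g x +_) (∑-+ xs f g)) (+-+-comm (f x) (g x) _ _)
    where +-+-comm : ∀ a b c d → a + b + (c + d) ≡ a + c + (b + d)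
          +-+-comm = solve-∀

  ∑-*ˡ : ∀ (xs : List A) k f → ∑[ x ∈ xs ] (k * f x) ≡ k * ∑ xs f
  ∑-*ˡ []       k f = sym (*-zeroʳ k)
  ∑-*ˡ (x ∷ xs) k f = trans (cong (k * f x +_) (∑-*ˡ xs k f)) (sym (*-distribˡ-+ k (f x) _))

  ∑-*ʳ : ∀ (xs : List A) k f → ∑[ x ∈ xs ] (f x * k) ≡ ∑ xs f * k
  ∑-*ʳ xs k f = trans (∑-cong xs (λ x → *-comm (f x) k)) (trans (∑-*ˡ xs k f) (*-comm k _))

  ∑-const : ∀ (xs : List A) k → ∑[ x ∈ xs ] k ≡ length xs * k
  ∑-const []       k = refl
  ∑-const (x ∷ xs) k = cong (k +_) (∑-const xs k)

  ∑-1 : ∀ (xs : List A) → ∑[ x ∈ xs ] 1 ≡ length xs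
  ∑-1 []       = refl
  ∑-1 (x ∷ xs) = cong suc (∑-1 xs)

  ∑-zero : ∀ (xs : List A) → ∑[ x ∈ xs ] 0 ≡ 0
  ∑-zero []       = refl
  ∑-zero (x ∷ xs) = ∑-zero xs

  term≤∑ : ∀ {xs : List A} {x} f → x ∈ xs → f x ≤ ∑ xs f
  term≤∑ f (here refl) = m≤m+n _ _
  term≤∑ f (there x∈xs) = ≤-trans (term≤∑ f x∈xs) (m≤n+m _ _)

module _ {A : Set a} {B : Set b} where

  ∑-map : ∀ (g : A → B) (xs : List A) f → ∑ (map g xs) f ≡ ∑[ x ∈ xs ] f (g x)
  ∑-map g xs f = cong sum (sym (map-∘ xs))

  ∑-concatMap : ∀ (g : A → List B) (xs : List A) f →
                ∑ (concatMap g xs) f ≡ ∑[ x ∈ xs ] ∑ (g x) f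
  ∑-concatMap g []       f = refl
  ∑-concatMap g (x ∷ xs) f =
    trans (∑-++ (g x) (concatMap g xs) f) (cong (∑ (g x) f +_) (∑-concatMap g xs f))

  ∑-swap : ∀ (xs : List A) (ys : List B) (f : A → B → ℕ) →
           ∑[ x ∈ xs ] ∑[ y ∈ ys ] f x y ≡ ∑[ y ∈ ys ] ∑[ x ∈ xs ] f x y
  ∑-swap []       ys f = sym (∑-zero ys)
  ∑-swap (x ∷ xs) ys f =
    trans (cong (∑ ys (f x) +_) (∑-swap xs ys f)) (sym (∑-+ ys (f x) (λ y → ∑[ x ∈ xs ] f x y)))

𝟙 : Dec P → ℕ
𝟙 (yes _) = 1
𝟙 (no _)  = 0

𝟙-yes : (d : Dec P) → P → 𝟙 d ≡ 1
𝟙-yes (yes _) p = refl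
𝟙-yes (no ¬p) p = ⊥-elim (¬p p)

𝟙-no : (d : Dec P) → ¬ P → 𝟙 d ≡ 0
𝟙-no (yes p) ¬p = ⊥-elim (¬p p)
𝟙-no (no _)  ¬p = refl

𝟙-⇔ : {Q : Set q} (d : Dec P) (e : Dec Q) → (P → Q) → (Q → P) → 𝟙 d ≡ 𝟙 e
𝟙-⇔ (yes p) e to from = sym (𝟙-yes e (to p))
𝟙-⇔ (no ¬p) e to from = sym (𝟙-no e (¬p ∘ from))

𝟙-× : {Q : Set q} (d : Dec P) (e : Dec Q) → 𝟙 (d ×-dec e) ≡ 𝟙 d * 𝟙 e
𝟙-× (yes _) (yes _) = refl
𝟙-× (yes _) (no _)  = refl
𝟙-× (no _)  _       = refl

𝟙-*-cong : (d : Dec P) {m n : ℕ} → (P → m ≡ n) → 𝟙 d * m ≡ 𝟙 d * n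
𝟙-*-cong (yes p) m≡n = cong (1 *_) (m≡n p)
𝟙-*-cong (no _)  m≡n = refl

xor-cancelˡ : ∀ x y → x xor (x xor y) ≡ y
xor-cancelˡ false y = refl
xor-cancelˡ true  y = not-involutive y

xor-cancelʳ : ∀ x y → (x xor y) xor y ≡ x
xor-cancelʳ false y = xor-same y
xor-cancelʳ true  y = xor-inverseˡ y

xor≡⇒≡xor : ∀ x y z → x xor y ≡ z → x ≡ y xor z
xor≡⇒≡xor x y _ refl = sym (trans (xor-comm y (x xor y)) (xor-cancelʳ x y))

≡xor⇒xor≡ : ∀ x y z → x ≡ y xor z → x xor y ≡ z
≡xor⇒xor≡ _ y z refl = trans (xor-comm (y xor z) y) (xor-cancelˡ y z)

length-filter : ∀ {A : Set a} {P : A → Set p} (P? : ∀ x → Dec (P x)) xs →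
                length (filter P? xs) ≡ ∑[ x ∈ xs ] 𝟙 (P? x)
length-filter P? []       = refl
length-filter P? (x ∷ xs) with P? x
... | yes _ = cong suc (length-filter P? xs)
... | no _  = length-filter P? xs

m*m≤n*n⇒m≤n : ∀ m n → m * m ≤ n * n → m ≤ n
m*m≤n*n⇒m≤n m n m*m≤n*n with m ≤? n
... | yes m≤n = m≤n
... | no m≰n  = ⊥-elim (<⇒≱ (*-mono-< (≰⇒> m≰n) (≰⇒> m≰n)) m*m≤n*n)

4*m*n≤[m+n]*[m+n]-ordered : ∀ {m n} → m ≤ n → 4 * (m * n) ≤ (m + n) * (m + n)
4*m*n≤[m+n]*[m+n]-ordered {m} m≤n with k , refl ← m≤n⇒∃[o]m+o≡n m≤n =
  subst (4 * (m * (m + k)) ≤_) (expand m k) (m≤m+n _ (k * k))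
  where expand : ∀ m k → 4 * (m * (m + k)) + k * k ≡ (m + (m + k)) * (m + (m + k))
        expand = solve-∀

4*m*n≤[m+n]*[m+n] : ∀ m n → 4 * (m * n) ≤ (m + n) * (m + n)
4*m*n≤[m+n]*[m+n] m n with ≤-total m n
... | inj₁ m≤n = 4*m*n≤[m+n]*[m+n]-ordered m≤n
... | inj₂ n≤m = subst₂ _≤_ (cong (4 *_) (*-comm n m)) (cong (λ s → s * s) (+-comm n m))
                   (4*m*n≤[m+n]*[m+n]-ordered n≤m)

2*x*r≤y*s′+s*z : ∀ x r y z s s′ → x * x ≤ y * z → r * r ≤ s * s′ →
                 2 * (x * r) ≤ y * s′ + s * z
2*x*r≤y*s′+s*z x r y z s s′ x²≤yz r²≤ss′ = m*m≤n*n⇒m≤n _ _ (begin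
  (2 * (x * r)) * (2 * (x * r)) ≡⟨ lhs x r ⟩
  4 * ((x * x) * (r * r))       ≤⟨ *-monoʳ-≤ 4 (*-mono-≤ x²≤yz r²≤ss′) ⟩
  4 * ((y * z) * (s * s′))      ≡⟨ cong (4 *_) (middle y z s s′) ⟩
  4 * ((y * s′) * (s * z))      ≤⟨ 4*m*n≤[m+n]*[m+n] (y * s′) (s * z) ⟩
  (y * s′ + s * z) * (y * s′ + s * z) ∎)
  where
  open ≤-Reasoning
  lhs : ∀ x r → (2 * (x * r)) * (2 * (x * r)) ≡ 4 * ((x * x) * (r * r))
  lhs = solve-∀
  middle : ∀ y z s s′ → (y * z) * (s * s′) ≡ (y * s′) * (s * z)
  middle = solve-∀

∑-Cauchy-Schwarz : ∀ {A : Set a} (xs : List A) (X Y Z : A → ℕ) →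
                   (∀ x → X x * X x ≤ Y x * Z x) → ∑ xs X * ∑ xs X ≤ ∑ xs Y * ∑ xs Z
∑-Cauchy-Schwarz []       X Y Z X²≤YZ = z≤n
∑-Cauchy-Schwarz (x ∷ xs) X Y Z X²≤YZ = begin
  (X x + R) * (X x + R)                      ≡⟨ expand (X x) R ⟩
  X x * X x + 2 * (X x * R) + R * R          ≤⟨ +-mono-≤ (+-mono-≤ (X²≤YZ x) cross) ih ⟩
  Y x * Z x + (Y x * SZ + SY * Z x) + SY * SZ ≡⟨ collect (Y x) (Z x) SY SZ ⟩
  (Y x + SY) * (Z x + SZ)                    ∎
  where
  open ≤-Reasoning
  R SY SZ : ℕ
  R = ∑ xs X
  SY = ∑ xs Y
  SZ = ∑ xs Z
  ih : R * R ≤ SY * SZ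
  ih = ∑-Cauchy-Schwarz xs X Y Z X²≤YZ
  cross : 2 * (X x * R) ≤ Y x * SZ + SY * Z x
  cross = 2*x*r≤y*s′+s*z (X x) R (Y x) (Z x) SY SZ (X²≤YZ x) ih
  expand : ∀ a r → (a + r) * (a + r) ≡ a * a + 2 * (a * r) + r * r
  expand = solve-∀
  collect : ∀ y z s s′ → y * z + (y * s′ + s * z) + s * s′ ≡ (y + s) * (z + s′)
  collect = solve-∀

∑-square≤ : ∀ (xs : List A) X B → (∀ x → X x * X x ≤ B) →
            ∑ xs X * ∑ xs X ≤ (length xs * length xs) * B
∑-square≤ xs X B X²≤B = begin
  ∑ xs X * ∑ xs X               ≤⟨ ∑-Cauchy-Schwarz xs X (λ _ → 1) (λ _ → B) X²≤1*B ⟩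
  ∑[ x ∈ xs ] 1 * ∑[ x ∈ xs ] B ≡⟨ cong₂ _*_ (∑-1 xs) (∑-const xs B) ⟩
  length xs * (length xs * B)   ≡⟨ *-assoc (length xs) _ _ ⟨
  (length xs * length xs) * B   ∎
  where
  open ≤-Reasoning
  X²≤1*B : ∀ x → X x * X x ≤ 1 * B
  X²≤1*B x = ≤-trans (X²≤B x) (≤-reflexive (sym (*-identityˡ B)))

module _ {s ℓ} (S : DecSetoid s ℓ) where

  open DecSetoid S renaming (_≟_ to _≈?_; refl to ≈-refl; sym to ≈-sym; trans to ≈-trans)
  open SetoidUnique setoid using () renaming (Unique to Distinct)

  count-absent : ∀ {ys z} → All (λ y → ¬ z ≈ y) ys → ∑[ y ∈ ys ] 𝟙 (z ≈? y) ≡ 0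
  count-absent []                 = refl
  count-absent {z = z} (z≉y ∷ z≉ys) = trans (cong (_+ _) (𝟙-no (z ≈? _) z≉y)) (count-absent z≉ys)

  private
    distinct-from : ∀ {y z ys} → z ≈ y → All (λ y′ → ¬ y ≈ y′) ys → All (λ y′ → ¬ z ≈ y′) ys
    distinct-from z≈y = All.map (λ y≉y′ z≈y′ → y≉y′ (≈-trans (≈-sym z≈y) z≈y′))

  count-distinct≤1 : ∀ {ys} → Distinct ys → ∀ z → ∑[ y ∈ ys ] 𝟙 (z ≈? y) ≤ 1
  count-distinct≤1 []                         z = z≤n
  count-distinct≤1 {y ∷ _} (y≉ys ∷ ys-distinct) z with z ≈? y
  ... | yes z≈y = ≤-reflexive (cong suc (count-absent (distinct-from z≈y y≉ys)))
  ... | no _    = count-distinct≤1 ys-distinct z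

  count-distinct≡1 : ∀ {ys z} → Distinct ys → Any (z ≈_) ys → ∑[ y ∈ ys ] 𝟙 (z ≈? y) ≡ 1
  count-distinct≡1 {y ∷ _} {z} (y≉ys ∷ ys-distinct) z∈ys with z ≈? y
  ... | yes z≈y = cong suc (count-absent (distinct-from z≈y y≉ys))
  ... | no z≉y  = count-distinct≡1 ys-distinct (Any.tail z≉y z∈ys)

  multiplicity : List Carrier → Carrier → ℕ
  multiplicity L z = ∑[ x ∈ L ] 𝟙 (x ≈? z)

  multiplicity-cong : ∀ L {z z′} → z ≈ z′ → multiplicity L z ≡ multiplicity L z′
  multiplicity-cong L z≈z′ = ∑-cong L (λ x →
    𝟙-⇔ (x ≈? _) (x ≈? _) (λ x≈z → ≈-trans x≈z z≈z′) (λ x≈z′ → ≈-trans x≈z′ (≈-sym z≈z′)))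

  module EquivalenceClasses (L : List Carrier) where

    representatives : List Carrier
    representatives = deduplicate _≈?_ L

    private
      Q : List Carrier
      Q = representatives
      μ : Carrier → ℕ
      μ = multiplicity L

    representatives-distinct : Distinct Q
    representatives-distinct = deduplicate-! S L

    representative-count≤1 : ∀ z → ∑[ q ∈ Q ] 𝟙 (z ≈? q) ≤ 1
    representative-count≤1 = count-distinct≤1 representatives-distinct

    representative-count≡1 : ∀ {x} → x ∈ L → ∑[ q ∈ Q ] 𝟙 (x ≈? q) ≡ 1
    representative-count≡1 x∈L = count-distinct≡1 representatives-distinct
      (Any.deduplicate⁺ _≈?_ (λ y≈y′ x≈y′ → ≈-trans x≈y′ (≈-sym y≈y′))
                             (Any.map (λ { refl → ≈-refl }) x∈L))

    ∑-by-classes : ∀ f → (∀ {x y} → x ≈ y → f x ≡ f y) → ∑[ q ∈ Q ] (μ q * f q) ≡ ∑ L f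
    ∑-by-classes f f-cong = begin
      ∑[ q ∈ Q ] (μ q * f q)
        ≡⟨ ∑-cong Q (λ q → ∑-*ʳ L (f q) (λ x → 𝟙 (x ≈? q))) ⟨
      ∑[ q ∈ Q ] ∑[ x ∈ L ] (𝟙 (x ≈? q) * f q)
        ≡⟨ ∑-cong Q (λ q → ∑-cong L (λ x → 𝟙-*-cong (x ≈? q) (f-cong ∘ ≈-sym))) ⟩
      ∑[ q ∈ Q ] ∑[ x ∈ L ] (𝟙 (x ≈? q) * f x)
        ≡⟨ ∑-swap Q L _ ⟩
      ∑[ x ∈ L ] ∑[ q ∈ Q ] (𝟙 (x ≈? q) * f x)
        ≡⟨ ∑-cong L (λ x → ∑-*ʳ Q (f x) (λ q → 𝟙 (x ≈? q))) ⟩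
      ∑[ x ∈ L ] (∑[ q ∈ Q ] 𝟙 (x ≈? q) * f x)
        ≡⟨ ∑-cong-local (All.tabulate (λ {x} x∈L →
             trans (cong (_* f x) (representative-count≡1 x∈L)) (*-identityˡ (f x)))) ⟩
      ∑ L f ∎
      where open ≡-Reasoning

  module _ (φ : Carrier → Carrier) (φ-cong : ∀ {x y} → x ≈ y → φ x ≈ φ y)
           (φ-involutive : ∀ x → φ (φ x) ≈ x) where

    private
      φ-swap : ∀ {x y} → x ≈ φ y → φ x ≈ y
      φ-swap {x} {y} x≈φy = ≈-trans (φ-cong x≈φy) (φ-involutive y)

    twisted-pairs≤pairs : ∀ L →
      ∑[ x ∈ L ] ∑[ y ∈ L ] 𝟙 (x ≈? φ y) ≤ ∑[ x ∈ L ] ∑[ y ∈ L ] 𝟙 (x ≈? y)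
    twisted-pairs≤pairs L = begin
      ∑[ x ∈ L ] ∑[ y ∈ L ] 𝟙 (x ≈? φ y) ≡⟨ ∑-swap L L _ ⟩
      ∑[ y ∈ L ] μ (φ y)                ≡⟨ ∑-by-classes (μ ∘ φ) (multiplicity-cong L ∘ φ-cong) ⟨
      ∑[ q ∈ Q ] (μ q * μ (φ q))        ≤⟨ m*m≤n*n⇒m≤n _ _ Cauchy-Schwarz ⟩
      ∑[ q ∈ Q ] (μ q * μ q)            ≡⟨ ∑-by-classes μ (multiplicity-cong L) ⟩
      ∑[ y ∈ L ] μ y                    ≡⟨ ∑-swap L L _ ⟨
      ∑[ x ∈ L ] ∑[ y ∈ L ] 𝟙 (x ≈? y)   ∎
      where
      open ≤-Reasoning
      open EquivalenceClasses L
      Q : List Carrier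
      Q = representatives
      μ : Carrier → ℕ
      μ = multiplicity L

      squares∘φ≤squares : ∑[ q ∈ Q ] (μ (φ q) * μ (φ q)) ≤ ∑[ q ∈ Q ] (μ q * μ q)
      squares∘φ≤squares = begin
        ∑[ q ∈ Q ] (μ (φ q) * μ (φ q))
          ≡⟨ ∑-cong Q (λ q → ∑-*ʳ L (μ (φ q)) (λ x → 𝟙 (x ≈? φ q))) ⟨
        ∑[ q ∈ Q ] ∑[ x ∈ L ] (𝟙 (x ≈? φ q) * μ (φ q))
          ≡⟨ ∑-cong Q (λ q → ∑-cong L (λ x → 𝟙-*-cong (x ≈? φ q) (multiplicity-cong L ∘ ≈-sym))) ⟩
        ∑[ q ∈ Q ] ∑[ x ∈ L ] (𝟙 (x ≈? φ q) * μ x)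
          ≡⟨ ∑-swap Q L _ ⟩
        ∑[ x ∈ L ] ∑[ q ∈ Q ] (𝟙 (x ≈? φ q) * μ x)
          ≡⟨ ∑-cong L (λ x → ∑-cong Q (λ q → cong (_* μ x)
               (𝟙-⇔ (x ≈? φ q) (φ x ≈? q) φ-swap (≈-sym ∘ φ-swap ∘ ≈-sym)))) ⟩
        ∑[ x ∈ L ] ∑[ q ∈ Q ] (𝟙 (φ x ≈? q) * μ x)
          ≡⟨ ∑-cong L (λ x → ∑-*ʳ Q (μ x) (λ q → 𝟙 (φ x ≈? q))) ⟩
        ∑[ x ∈ L ] (∑[ q ∈ Q ] 𝟙 (φ x ≈? q) * μ x)
          ≤⟨ ∑-mono L (λ x → *-monoˡ-≤ (μ x) (representative-count≤1 (φ x))) ⟩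
        ∑[ x ∈ L ] (1 * μ x)
          ≡⟨ ∑-cong L (λ x → *-identityˡ (μ x)) ⟩
        ∑[ x ∈ L ] μ x
          ≡⟨ ∑-by-classes μ (multiplicity-cong L) ⟨
        ∑[ q ∈ Q ] (μ q * μ q) ∎

      Cauchy-Schwarz : ∑[ q ∈ Q ] (μ q * μ (φ q)) * ∑[ q ∈ Q ] (μ q * μ (φ q))
                       ≤ ∑[ q ∈ Q ] (μ q * μ q) * ∑[ q ∈ Q ] (μ q * μ q)
      Cauchy-Schwarz = ≤-trans
        (∑-Cauchy-Schwarz Q (λ q → μ q * μ (φ q)) (λ q → μ q * μ q) (λ q → μ (φ q) * μ (φ q))
          (λ q → ≤-reflexive (interchange (μ q) (μ (φ q)))))
        (*-monoʳ-≤ (∑[ q ∈ Q ] (μ q * μ q)) squares∘φ≤squares)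
        where interchange : ∀ a b → (a * b) * (a * b) ≡ (a * a) * (b * b)
              interchange = solve-∀

choices : Vec (List A) m → List (Vec A m)
choices []      = [] ∷ []
choices (L ∷ T) = concatMap (λ x → map (x ∷_) (choices T)) L

∑-choices-∷ : ∀ (L : List A) (T : Vec (List A) m) h →
              ∑ (choices (L ∷ T)) h ≡ ∑[ x ∈ L ] ∑[ w ∈ choices T ] h (x ∷ w)
∑-choices-∷ L T h = trans (∑-concatMap _ L h) (∑-cong L (λ x → ∑-map (x ∷_) (choices T) h))

tuples≡choices : ∀ (S : List A) m → tuples S m ≡ choices (replicate m S)
tuples≡choices S zero    = refl
tuples≡choices S (suc m) = cong (λ W → concatMap (λ x → map (x ∷_) W) S) (tuples≡choices S m)

∑-choices-replicate-+ : ∀ (S : List A) m k h →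
  ∑ (choices (replicate (m + k) S)) h ≡
  ∑[ u ∈ choices (replicate m S) ] ∑[ v ∈ choices (replicate k S) ] h (u ++ v)
∑-choices-replicate-+ S zero    k h = sym (+-identityʳ _)
∑-choices-replicate-+ S (suc m) k h = begin
  ∑ (choices (replicate (suc m + k) S)) h
    ≡⟨ ∑-choices-∷ S (replicate (m + k) S) h ⟩
  ∑[ x ∈ S ] ∑[ w ∈ choices (replicate (m + k) S) ] h (x ∷ w)
    ≡⟨ ∑-cong S (λ x → ∑-choices-replicate-+ S m k (λ w → h (x ∷ w))) ⟩
  ∑[ x ∈ S ] ∑[ u ∈ choices (replicate m S) ] ∑[ v ∈ choices (replicate k S) ] h (x ∷ u ++ v)
    ≡⟨ ∑-choices-∷ S (replicate m S) _ ⟨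
  ∑[ u ∈ choices (replicate (suc m) S) ] ∑[ v ∈ choices (replicate k S) ] h (u ++ v) ∎
  where open ≡-Reasoning

∏ : Vec A m → (A → ℕ) → ℕ
∏ []       f = 1
∏ (x ∷ xs) f = f x * ∏ xs f

∏-replicate : ∀ m (x : A) f → ∏ (replicate m x) f ≡ f x ^ m
∏-replicate zero    x f = refl
∏-replicate (suc m) x f = cong (f x *_) (∏-replicate m x f)

count-choices : ∀ (T : Vec (List A) m) → ∑[ w ∈ choices T ] 1 ≡ ∏ T length
count-choices []      = refl
count-choices (L ∷ T) = begin
  ∑[ w ∈ choices (L ∷ T) ] 1      ≡⟨ ∑-choices-∷ L T _ ⟩
  ∑[ x ∈ L ] ∑[ w ∈ choices T ] 1 ≡⟨ ∑-cong L (λ _ → count-choices T) ⟩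
  ∑[ x ∈ L ] ∏ T length           ≡⟨ ∑-const L _ ⟩
  length L * ∏ T length           ∎
  where open ≡-Reasoning

∑-allFin-select : ∀ (b : Fin σ) (v : Fin σ → ℕ) → ∑[ x ∈ allFin σ ] (𝟙 (b ≟ x) * v x) ≡ v b
∑-allFin-select {σ} b v = begin
  ∑[ x ∈ Σ ] (𝟙 (b ≟ x) * v x) ≡⟨ ∑-cong Σ (λ x → 𝟙-*-cong (b ≟ x) (λ b≡x → cong v (sym b≡x))) ⟩
  ∑[ x ∈ Σ ] (𝟙 (b ≟ x) * v b) ≡⟨ ∑-*ʳ Σ (v b) (λ x → 𝟙 (b ≟ x)) ⟩
  ∑[ x ∈ Σ ] 𝟙 (b ≟ x) * v b   ≡⟨ cong (_* v b) (count-distinct≡1 (≡-decSetoid σ) (allFin⁺ σ) (∈-allFin b)) ⟩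
  1 * v b                      ≡⟨ *-identityˡ (v b) ⟩
  v b                          ∎
  where
  open ≡-Reasoning
  Σ : List (Fin σ)
  Σ = allFin σ

Word : ℕ → ℕ → Set
Word σ m = Vec (Fin σ) m

words : ∀ σ m → List (Word σ m)
words σ m = choices (replicate m (allFin σ))

parity : Fin σ → Word σ m → Bool
parity b []      = false
parity b (x ∷ w) = does (x ≟ b) xor parity b w

Even : Word σ m → Set
Even w = ∀ b → parity b w ≡ false

even? : (w : Word σ m) → Dec (Even w)
even? w = all? (λ b → parity b w ≟ᵇ false)

parity-insertAt : ∀ (w : Word σ n) k b b′ →
                  parity b′ (insertAt w k b) ≡ does (b ≟ b′) xor parity b′ w
parity-insertAt w       zero    b b′ = refl
parity-insertAt (x ∷ w) (suc k) b b′ = begin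
  [x] xor parity b′ (insertAt w k b) ≡⟨ cong ([x] xor_) (parity-insertAt w k b b′) ⟩
  [x] xor ([b] xor parity b′ w)      ≡⟨ xor-assoc [x] _ _ ⟨
  ([x] xor [b]) xor parity b′ w      ≡⟨ cong (_xor parity b′ w) (xor-comm [x] [b]) ⟩
  ([b] xor [x]) xor parity b′ w      ≡⟨ xor-assoc [b] _ _ ⟩
  [b] xor ([x] xor parity b′ w)      ∎
  where
  open ≡-Reasoning
  [x] [b] : Bool
  [x] = does (x ≟ b′)
  [b] = does (b ≟ b′)

parity≡true⇒occurs : ∀ (w : Word σ n) b → parity b w ≡ true → ∃ λ k → lookup w k ≡ b
parity≡true⇒occurs (x ∷ w) b odd with x ≟ b
... | yes x≡b = zero , x≡b
... | no _    = let k , wₖ≡b = parity≡true⇒occurs w b odd in suc k , wₖ≡b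

Even-∷⇒occurs : ∀ b (w : Word σ n) → Even (b ∷ w) → ∃ λ k → lookup w k ≡ b
Even-∷⇒occurs b w even = parity≡true⇒occurs w b (begin
  parity b w                       ≡⟨ not-involutive _ ⟨
  not (true xor parity b w)        ≡⟨ cong (λ t → not (t xor parity b w)) (dec-true (b ≟ b) refl) ⟨
  not (parity b (b ∷ w))           ≡⟨ cong not (even b) ⟩
  true                             ∎)
  where open ≡-Reasoning

Even-∷⇒Even-removeAt : ∀ b (w : Word σ (suc n)) k → lookup w k ≡ b → Even (b ∷ w) →
                       Even (removeAt w k)
Even-∷⇒Even-removeAt {σ = σ} {n = n} b w k wₖ≡b even b′ = begin
  parity b′ r                                   ≡⟨ xor-cancelˡ [b] _ ⟨
  [b] xor ([b] xor parity b′ r)                 ≡⟨ cong ([b] xor_) (parity-insertAt r k b b′) ⟨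
  [b] xor parity b′ (insertAt r k b)            ≡⟨ cong (λ x → [b] xor parity b′ (insertAt r k x)) wₖ≡b ⟨
  [b] xor parity b′ (insertAt r k (lookup w k)) ≡⟨ cong (λ v → [b] xor parity b′ v) (insertAt-removeAt w k) ⟩
  parity b′ (b ∷ w)                             ≡⟨ even b′ ⟩
  false                                         ∎
  where
  open ≡-Reasoning
  r : Word σ n
  r = removeAt w k
  [b] : Bool
  [b] = does (b ≟ b′)

¬Even-singleton : ∀ (b : Fin σ) → ¬ Even (b ∷ [])
¬Even-singleton b even with b ≟ b | even b
... | yes _  | ()
... | no b≢b | _ = b≢b refl

evenSum : (Word σ m → ℕ) → ℕ
evenSum {σ} {m} F = ∑[ w ∈ words σ m ] (𝟙 (even? w) * F w)

∑-words-insertAt : ∀ (k : Fin (suc n)) (b : Fin σ) (H : Word σ (suc n) → ℕ) →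
  ∑[ w ∈ words σ (suc n) ] (𝟙 (b ≟ lookup w k) * H w) ≡ ∑[ u ∈ words σ n ] H (insertAt u k b)
∑-words-insertAt {n} {σ} zero b H = begin
  ∑[ w ∈ words σ (suc n) ] (𝟙 (b ≟ lookup w zero) * H w)
    ≡⟨ ∑-choices-∷ (allFin σ) (replicate n (allFin σ)) _ ⟩
  ∑[ x ∈ allFin σ ] ∑[ u ∈ words σ n ] (𝟙 (b ≟ x) * H (x ∷ u))
    ≡⟨ ∑-cong (allFin σ) (λ x → ∑-*ˡ (words σ n) (𝟙 (b ≟ x)) _) ⟩
  ∑[ x ∈ allFin σ ] (𝟙 (b ≟ x) * ∑[ u ∈ words σ n ] H (x ∷ u))
    ≡⟨ ∑-allFin-select b _ ⟩
  ∑[ u ∈ words σ n ] H (b ∷ u) ∎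
  where open ≡-Reasoning
∑-words-insertAt {suc n} {σ} (suc k) b H = begin
  ∑[ w ∈ words σ (suc (suc n)) ] (𝟙 (b ≟ lookup w (suc k)) * H w)
    ≡⟨ ∑-choices-∷ (allFin σ) (replicate (suc n) (allFin σ)) _ ⟩
  ∑[ x ∈ allFin σ ] ∑[ w ∈ words σ (suc n) ] (𝟙 (b ≟ lookup w k) * H (x ∷ w))
    ≡⟨ ∑-cong (allFin σ) (λ x → ∑-words-insertAt k b (λ w → H (x ∷ w))) ⟩
  ∑[ x ∈ allFin σ ] ∑[ u ∈ words σ n ] H (x ∷ insertAt u k b)
    ≡⟨ ∑-choices-∷ (allFin σ) (replicate n (allFin σ)) _ ⟨
  ∑[ u ∈ words σ (suc n) ] H (insertAt u (suc k) b) ∎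
  where open ≡-Reasoning

first-letter-paired : ∀ (b : Fin σ) (w : Word σ (suc n)) v →
  𝟙 (even? (b ∷ w)) * v ≤ ∑[ k ∈ allFin (suc n) ] (𝟙 (b ≟ lookup w k) * (𝟙 (even? (removeAt w k)) * v))
first-letter-paired b w v with even? (b ∷ w)
... | no _     = z≤n
... | yes even with k , wₖ≡b ← Even-∷⇒occurs b w even = begin
  1 * v           ≡⟨ cong (1 *_) (*-identityˡ v) ⟨
  1 * (1 * v)     ≡⟨ cong₂ (λ i j → i * (j * v)) (𝟙-yes (b ≟ lookup w k) (sym wₖ≡b))
                       (𝟙-yes (even? (removeAt w k)) (Even-∷⇒Even-removeAt b w k wₖ≡b even)) ⟨
  term k          ≤⟨ term≤∑ term (∈-allFin k) ⟩
  ∑ (allFin _) term ∎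
  where
  open ≤-Reasoning
  term : Fin (suc _) → ℕ
  term k = 𝟙 (b ≟ lookup w k) * (𝟙 (even? (removeAt w k)) * v)

pairedSum : (Word σ (suc (suc n)) → ℕ) → Fin (suc n) → ℕ
pairedSum {σ} F k = ∑[ b ∈ allFin σ ] evenSum (λ u → F (b ∷ insertAt u k b))

evenSum-pairing : ∀ (F : Word σ (suc (suc n)) → ℕ) → evenSum F ≤ ∑ (allFin (suc n)) (pairedSum F)
evenSum-pairing {σ} {n} F = begin
  evenSum F
    ≡⟨ ∑-choices-∷ (allFin σ) (replicate (suc n) (allFin σ)) _ ⟩
  ∑[ b ∈ Σ ] ∑[ w ∈ words σ (suc n) ] (𝟙 (even? (b ∷ w)) * F (b ∷ w))
    ≤⟨ ∑-mono Σ (λ b → ∑-mono (words σ (suc n)) (λ w → first-letter-paired b w (F (b ∷ w)))) ⟩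
  ∑[ b ∈ Σ ] ∑[ w ∈ words σ (suc n) ] ∑[ k ∈ Ks ] (𝟙 (b ≟ lookup w k) * G b w k)
    ≡⟨ ∑-cong Σ (λ b → ∑-swap (words σ (suc n)) Ks _) ⟩
  ∑[ b ∈ Σ ] ∑[ k ∈ Ks ] ∑[ w ∈ words σ (suc n) ] (𝟙 (b ≟ lookup w k) * G b w k)
    ≡⟨ ∑-cong Σ (λ b → ∑-cong Ks (λ k → ∑-words-insertAt k b _)) ⟩
  ∑[ b ∈ Σ ] ∑[ k ∈ Ks ] ∑[ u ∈ words σ n ] G b (insertAt u k b) k
    ≡⟨ ∑-cong Σ (λ b → ∑-cong Ks (λ k → ∑-cong (words σ n) (λ u →
         cong (λ v → 𝟙 (even? v) * F (b ∷ insertAt u k b)) (removeAt-insertAt u k b)))) ⟩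
  ∑[ b ∈ Σ ] ∑[ k ∈ Ks ] evenSum (λ u → F (b ∷ insertAt u k b))
    ≡⟨ ∑-swap Σ Ks _ ⟩
  ∑ Ks (pairedSum F) ∎
  where
  open ≤-Reasoning
  Σ : List (Fin σ)
  Σ = allFin σ
  Ks : List (Fin (suc n))
  Ks = allFin (suc n)
  G : Fin σ → Word σ (suc n) → Fin (suc n) → ℕ
  G b w k = 𝟙 (even? (removeAt w k)) * F (b ∷ w)

pairings : ℕ → ℕ
pairings zero          = 1
pairings (suc zero)    = 0
pairings (suc (suc n)) = suc n * pairings n

weight : Vec (Fin σ → ℕ) m → Word σ m → ℕ
weight []       []      = 1
weight (g ∷ gs) (b ∷ w) = g b * weight gs w

totalWeight : Vec (Fin σ → ℕ) m → ℕ
totalWeight         []       = 1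
totalWeight {σ = σ} (g ∷ gs) = ∑ (allFin σ) g * totalWeight gs

private
  *-exchange : ∀ x y z → x * (y * z) ≡ y * (x * z)
  *-exchange = solve-∀

weight-insertAt : ∀ (gs : Vec (Fin σ → ℕ) (suc n)) w k b →
                  weight gs (insertAt w k b) ≡ lookup gs k b * weight (removeAt gs k) w
weight-insertAt (g ∷ gs)           w       zero    b = refl
weight-insertAt (g ∷ gs@(_ ∷ _)) (x ∷ w) (suc k) b =
  trans (cong (g x *_) (weight-insertAt gs w k b)) (*-exchange (g x) (lookup gs k b) _)

totalWeight-removeAt : ∀ (gs : Vec (Fin σ → ℕ) (suc n)) k →
                       totalWeight gs ≡ ∑ (allFin σ) (lookup gs k) * totalWeight (removeAt gs k)
totalWeight-removeAt (g ∷ gs)           zero    = refl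
totalWeight-removeAt {σ} (g ∷ gs@(_ ∷ _)) (suc k) =
  trans (cong (∑ (allFin σ) g *_) (totalWeight-removeAt gs k))
        (*-exchange (∑ (allFin σ) g) (∑ (allFin σ) (lookup gs k)) _)

evenSum-[] : ∀ (F : Word σ 0 → ℕ) → evenSum F ≡ F []
evenSum-[] {σ} F = begin
  𝟙 (even? {σ} []) * F [] + 0 ≡⟨ +-identityʳ _ ⟩
  𝟙 (even? {σ} []) * F []     ≡⟨ cong (_* F []) (𝟙-yes (even? {σ} []) (λ _ → refl)) ⟩
  1 * F []                    ≡⟨ *-identityˡ (F []) ⟩
  F []                        ∎
  where open ≡-Reasoning

evenSum-singleton : ∀ (F : Word σ 1 → ℕ) → evenSum F ≡ 0
evenSum-singleton {σ} F = begin
  evenSum F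
    ≡⟨ ∑-choices-∷ (allFin σ) [] _ ⟩
  ∑[ b ∈ allFin σ ] (𝟙 (even? (b ∷ [])) * F (b ∷ []) + 0)
    ≡⟨ ∑-cong (allFin σ) (λ b →
         cong (λ i → i * F (b ∷ []) + 0) (𝟙-no (even? (b ∷ [])) (¬Even-singleton b))) ⟩
  ∑[ b ∈ allFin σ ] 0
    ≡⟨ ∑-zero (allFin σ) ⟩
  0 ∎
  where open ≡-Reasoning

-- In the application gsᵢ b is the number of keys of Tᵢ with first character b, and F a counts
-- the solutions whose first characters form the word a.
EvenSumBound : ℕ → ℕ → Set
EvenSumBound σ n = ∀ (gs : Vec (Fin σ → ℕ) n) K (F : Word σ n → ℕ) →
  (∀ w → F w * F w ≤ K * weight gs w) →
  evenSum F * evenSum F ≤ (pairings n * pairings n) * (K * totalWeight gs)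

evenSum-bound-0 : EvenSumBound σ 0
evenSum-bound-0 [] K F F²≤ = begin
  evenSum F * evenSum F ≡⟨ cong (λ s → s * s) (evenSum-[] F) ⟩
  F [] * F []           ≤⟨ F²≤ [] ⟩
  K * 1                 ≡⟨ *-identityˡ _ ⟨
  1 * (K * 1)           ∎
  where open ≤-Reasoning

evenSum-bound-1 : EvenSumBound σ 1
evenSum-bound-1 gs K F F²≤ = subst (λ s → s * s ≤ _) (sym (evenSum-singleton F)) z≤n

pairedSum-bound : EvenSumBound σ n →
  ∀ g (gs : Vec (Fin σ → ℕ) (suc n)) K (F : Word σ (suc (suc n)) → ℕ) →
  (∀ w → F w * F w ≤ K * weight (g ∷ gs) w) →
  ∀ k → pairedSum F k * pairedSum F k ≤ (pairings n * pairings n) * (K * totalWeight (g ∷ gs))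
pairedSum-bound {σ} {n} IH g gs K F F²≤ k = begin
  pairedSum F k * pairedSum F k
    ≤⟨ ∑-Cauchy-Schwarz Σ Y (λ b → C * g b) gₖ Y-bound ⟩
  ∑[ b ∈ Σ ] (C * g b) * ∑ Σ gₖ
    ≡⟨ cong (_* ∑ Σ gₖ) (∑-*ˡ Σ C g) ⟩
  (C * ∑ Σ g) * ∑ Σ gₖ
    ≡⟨ rearrange D² K (totalWeight gs′) (∑ Σ g) (∑ Σ gₖ) ⟩
  D² * (K * (∑ Σ g * (∑ Σ gₖ * totalWeight gs′)))
    ≡⟨ cong (λ t → D² * (K * (∑ Σ g * t))) (totalWeight-removeAt gs k) ⟨
  D² * (K * totalWeight (g ∷ gs)) ∎
  where
  open ≤-Reasoning
  Σ : List (Fin σ)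
  Σ = allFin σ
  D² : ℕ
  D² = pairings n * pairings n
  gₖ : Fin σ → ℕ
  gₖ = lookup gs k
  gs′ : Vec (Fin σ → ℕ) n
  gs′ = removeAt gs k
  C : ℕ
  C = D² * (K * totalWeight gs′)
  Y : Fin σ → ℕ
  Y b = evenSum (λ u → F (b ∷ insertAt u k b))

  rearrange : ∀ d K t x y → (d * (K * t) * x) * y ≡ d * (K * (x * (y * t)))
  rearrange = solve-∀
  shuffle : ∀ d K t x y → d * ((K * (x * y)) * t) ≡ (d * (K * t) * x) * y
  shuffle = solve-∀

  Y-bound : ∀ b → Y b * Y b ≤ (C * g b) * gₖ b
  Y-bound b = ≤-trans (IH gs′ (K * (g b * gₖ b)) _ F²≤-paired)
                      (≤-reflexive (shuffle D² K (totalWeight gs′) (g b) (gₖ b)))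
    where
    F²≤-paired : ∀ u → F (b ∷ insertAt u k b) * F (b ∷ insertAt u k b)
                       ≤ (K * (g b * gₖ b)) * weight gs′ u
    F²≤-paired u = ≤-trans (F²≤ (b ∷ insertAt u k b)) (≤-reflexive (begin-equality
      K * (g b * weight gs (insertAt u k b)) ≡⟨ cong (λ t → K * (g b * t)) (weight-insertAt gs u k b) ⟩
      K * (g b * (gₖ b * weight gs′ u))       ≡⟨ cong (K *_) (*-assoc (g b) _ _) ⟨
      K * (g b * gₖ b * weight gs′ u)         ≡⟨ *-assoc K _ _ ⟨
      (K * (g b * gₖ b)) * weight gs′ u       ∎))

evenSum-bound-step : EvenSumBound σ n → EvenSumBound σ (suc (suc n))
evenSum-bound-step {σ} {n} IH (g ∷ gs) K F F²≤ = begin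
  evenSum F * evenSum F
    ≤⟨ *-mono-≤ (evenSum-pairing F) (evenSum-pairing F) ⟩
  ∑ Ks (pairedSum F) * ∑ Ks (pairedSum F)
    ≤⟨ ∑-square≤ Ks (pairedSum F) _ (pairedSum-bound IH g gs K F F²≤) ⟩
  (length Ks * length Ks) * ((D * D) * W)
    ≡⟨ cong (λ l → (l * l) * ((D * D) * W)) (length-tabulate {n = suc n} (λ i → i)) ⟩
  (suc n * suc n) * ((D * D) * W)
    ≡⟨ interchange (suc n) D W ⟩
  (suc n * D) * (suc n * D) * W ∎
  where
  open ≤-Reasoning
  Ks : List (Fin (suc n))
  Ks = allFin (suc n)
  D W : ℕ
  D = pairings n
  W = K * totalWeight (g ∷ gs)
  interchange : ∀ l d w → (l * l) * ((d * d) * w) ≡ (l * d) * (l * d) * w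
  interchange = solve-∀

evenSum-bound : ∀ n → EvenSumBound σ n
evenSum-bound zero          = evenSum-bound-0
evenSum-bound (suc zero)    = evenSum-bound-1
evenSum-bound (suc (suc n)) = evenSum-bound-step (evenSum-bound n)

∅ : GenKey c σ
∅ _ _ = false

solutions : Vec (List (Key c σ)) m → GenKey c σ → ℕ
solutions T q = ∑[ w ∈ choices T ] 𝟙 (symDiff w ≐? q)

slice : List (Key (suc c) σ) → Fin σ → List (Key c σ)
slice []            b = []
slice ((x ∷ y) ∷ L) b with x ≟ b
... | yes _ = y ∷ slice L b
... | no _  = slice L b

∑-slices : ∀ (L : List (Key (suc c) σ)) h →
           ∑ L h ≡ ∑[ b ∈ allFin σ ] ∑[ y ∈ slice L b ] h (b ∷ y)
∑-slices {σ = σ} []            h = sym (∑-zero (allFin σ))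
∑-slices {σ = σ} ((x ∷ y) ∷ L) h = begin
  h (x ∷ y) + ∑ L h
    ≡⟨ cong₂ _+_ (∑-allFin-select x (λ b → h (b ∷ y))) (sym (∑-slices L h)) ⟨
  ∑[ b ∈ allFin σ ] (𝟙 (x ≟ b) * h (b ∷ y)) + ∑[ b ∈ allFin σ ] ∑[ y′ ∈ slice L b ] h (b ∷ y′)
    ≡⟨ ∑-+ (allFin σ) _ _ ⟨
  ∑[ b ∈ allFin σ ] (𝟙 (x ≟ b) * h (b ∷ y) + ∑[ y′ ∈ slice L b ] h (b ∷ y′))
    ≡⟨ ∑-cong (allFin σ) head-slice ⟩
  ∑[ b ∈ allFin σ ] ∑[ y′ ∈ slice ((x ∷ y) ∷ L) b ] h (b ∷ y′) ∎
  where
  open ≡-Reasoning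
  head-slice : ∀ b → 𝟙 (x ≟ b) * h (b ∷ y) + ∑[ y′ ∈ slice L b ] h (b ∷ y′)
                     ≡ ∑[ y′ ∈ slice ((x ∷ y) ∷ L) b ] h (b ∷ y′)
  head-slice b with x ≟ b
  ... | yes _ = cong (_+ ∑[ y′ ∈ slice L b ] h (b ∷ y′)) (*-identityˡ (h (b ∷ y)))
  ... | no _  = refl

∑-slice-lengths : ∀ (L : List (Key (suc c) σ)) → ∑[ b ∈ allFin σ ] length (slice L b) ≡ length L
∑-slice-lengths {σ = σ} L = begin
  ∑[ b ∈ allFin σ ] length (slice L b)      ≡⟨ ∑-cong (allFin σ) (λ b → ∑-1 (slice L b)) ⟨
  ∑[ b ∈ allFin σ ] ∑[ y ∈ slice L b ] 1    ≡⟨ ∑-slices L (λ _ → 1) ⟨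
  ∑[ x ∈ L ] 1                              ≡⟨ ∑-1 L ⟩
  length L                                  ∎
  where open ≡-Reasoning

slice-All : ∀ {P : Key (suc c) σ → Set} L b → All P L → All (λ y → P (b ∷ y)) (slice L b)
slice-All []            b []       = []
slice-All ((x ∷ y) ∷ L) b (p ∷ ps) with x ≟ b
... | yes refl = p ∷ slice-All L b ps
... | no _     = slice-All L b ps

slice-Unique : ∀ {L : List (Key (suc c) σ)} b → Unique L → Unique (slice L b)
slice-Unique {L = []}            b []                 = []
slice-Unique {L = (x ∷ y) ∷ L} b (x∷y∉L ∷ L-unique) with x ≟ b
... | yes refl = All.map (λ x∷y≢ y≡y′ → x∷y≢ (cong (x ∷_) y≡y′)) (slice-All L x x∷y∉L)
                 ∷ slice-Unique b L-unique
... | no _     = slice-Unique b L-unique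

sliceSizes : Vec (List (Key (suc c) σ)) m → Vec (Fin σ → ℕ) m
sliceSizes []      = []
sliceSizes (L ∷ T) = (λ b → length (slice L b)) ∷ sliceSizes T

weight-sliceSizes : ∀ (T : Vec (List (Key (suc c) σ)) m) a →
                    weight (sliceSizes T) a ≡ ∏ (zipWith slice T a) length
weight-sliceSizes []      []      = refl
weight-sliceSizes (L ∷ T) (b ∷ a) = cong (length (slice L b) *_) (weight-sliceSizes T a)

totalWeight-sliceSizes : ∀ (T : Vec (List (Key (suc c) σ)) m) →
                         totalWeight (sliceSizes T) ≡ ∏ T length
totalWeight-sliceSizes []      = refl
totalWeight-sliceSizes (L ∷ T) = cong₂ _*_ (∑-slice-lengths L) (totalWeight-sliceSizes T)

∑-choices-slices : ∀ (T : Vec (List (Key (suc c) σ)) m) H →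
  ∑ (choices T) H ≡ ∑[ a ∈ words σ m ] ∑[ ys ∈ choices (zipWith slice T a) ] H (zipWith _∷_ a ys)
∑-choices-slices []              H = sym (+-identityʳ _)
∑-choices-slices {σ = σ} {m = suc m} (L ∷ T) H = begin
  ∑ (choices (L ∷ T)) H
    ≡⟨ ∑-choices-∷ L T H ⟩
  ∑[ x ∈ L ] ∑[ w ∈ choices T ] H (x ∷ w)
    ≡⟨ ∑-cong L (λ x → ∑-choices-slices T (λ w → H (x ∷ w))) ⟩
  ∑[ x ∈ L ] ∑[ a ∈ words σ m ] ∑[ ys ∈ choices (zipWith slice T a) ] H (x ∷ zipWith _∷_ a ys)
    ≡⟨ ∑-slices L _ ⟩
  ∑[ b ∈ Σ ] ∑[ y ∈ slice L b ] ∑[ a ∈ words σ m ] ∑[ ys ∈ Ys a ] H ((b ∷ y) ∷ zipWith _∷_ a ys)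
    ≡⟨ ∑-cong Σ (λ b → ∑-swap (slice L b) (words σ m) _) ⟩
  ∑[ b ∈ Σ ] ∑[ a ∈ words σ m ] ∑[ y ∈ slice L b ] ∑[ ys ∈ Ys a ] H ((b ∷ y) ∷ zipWith _∷_ a ys)
    ≡⟨ ∑-cong Σ (λ b → ∑-cong (words σ m) (λ a → ∑-choices-∷ (slice L b) (zipWith slice T a) _)) ⟨
  ∑[ b ∈ Σ ] ∑[ a ∈ words σ m ] ∑[ ys ∈ choices (zipWith slice (L ∷ T) (b ∷ a)) ] H (zipWith _∷_ (b ∷ a) ys)
    ≡⟨ ∑-choices-∷ Σ (replicate m Σ) _ ⟨
  ∑[ a ∈ words σ (suc m) ] ∑[ ys ∈ choices (zipWith slice (L ∷ T) a) ] H (zipWith _∷_ a ys) ∎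
  where
  open ≡-Reasoning
  Σ : List (Fin σ)
  Σ = allFin σ
  Ys : Word σ m → List (Vec (Key _ σ) m)
  Ys a = choices (zipWith slice T a)

symDiff-zipWith-zero : ∀ (a : Word σ m) (ys : Vec (Key c σ) m) b →
                       symDiff (zipWith _∷_ a ys) zero b ≡ parity b a
symDiff-zipWith-zero []      []       b = refl
symDiff-zipWith-zero (x ∷ a) (y ∷ ys) b = cong (does (x ≟ b) xor_) (symDiff-zipWith-zero a ys b)

symDiff-zipWith-suc : ∀ (a : Word σ m) (ys : Vec (Key c σ) m) i b →
                      symDiff (zipWith _∷_ a ys) (suc i) b ≡ symDiff ys i b
symDiff-zipWith-suc []      []       i b = refl
symDiff-zipWith-suc (x ∷ a) (y ∷ ys) i b = cong (asSet y i b xor_) (symDiff-zipWith-suc a ys i b)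

𝟙-symDiff-zipWith : ∀ (a : Word σ m) (ys : Vec (Key c σ) m) →
  𝟙 (symDiff (zipWith _∷_ a ys) ≐? ∅) ≡ 𝟙 (even? a) * 𝟙 (symDiff ys ≐? ∅)
𝟙-symDiff-zipWith a ys =
  trans (𝟙-⇔ (symDiff (zipWith _∷_ a ys) ≐? ∅) (even? a ×-dec (symDiff ys ≐? ∅)) to from)
        (𝟙-× (even? a) (symDiff ys ≐? ∅))
  where
  to : symDiff (zipWith _∷_ a ys) ≐ ∅ → Even a × symDiff ys ≐ ∅
  to empty = (λ b → trans (sym (symDiff-zipWith-zero a ys b)) (empty zero b))
           , (λ i b → trans (sym (symDiff-zipWith-suc a ys i b)) (empty (suc i) b))
  from : Even a × symDiff ys ≐ ∅ → symDiff (zipWith _∷_ a ys) ≐ ∅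
  from (even , empty) zero    b = trans (symDiff-zipWith-zero a ys b) (even b)
  from (even , empty) (suc i) b = trans (symDiff-zipWith-suc a ys i b) (empty i b)

solutions∅-by-first-letters : ∀ (T : Vec (List (Key (suc c) σ)) m) →
  solutions T ∅ ≡ evenSum (λ a → solutions (zipWith slice T a) ∅)
solutions∅-by-first-letters {σ = σ} {m = m} T = begin
  solutions T ∅
    ≡⟨ ∑-choices-slices T _ ⟩
  ∑[ a ∈ words σ m ] ∑[ ys ∈ choices (zipWith slice T a) ] 𝟙 (symDiff (zipWith _∷_ a ys) ≐? ∅)
    ≡⟨ ∑-cong (words σ m) (λ a → ∑-cong (choices (zipWith slice T a)) (𝟙-symDiff-zipWith a)) ⟩
  ∑[ a ∈ words σ m ] ∑[ ys ∈ choices (zipWith slice T a) ] (𝟙 (even? a) * 𝟙 (symDiff ys ≐? ∅))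
    ≡⟨ ∑-cong (words σ m) (λ a → ∑-*ˡ (choices (zipWith slice T a)) (𝟙 (even? a)) _) ⟩
  evenSum (λ a → solutions (zipWith slice T a) ∅) ∎
  where open ≡-Reasoning

Unique⇒length≤1 : ∀ {L : List (Key 0 σ)} → Unique L → length L ≤ 1
Unique⇒length≤1 {L = []}          _                 = z≤n
Unique⇒length≤1 {L = [] ∷ []}      _                 = s≤s z≤n
Unique⇒length≤1 {L = [] ∷ [] ∷ _} (([]≢[] ∷ _) ∷ _) = ⊥-elim ([]≢[] refl)

solutions∅-bound : ∀ c (T : Vec (List (Key c σ)) m) → Vec.All Unique T →
  solutions T ∅ * solutions T ∅ ≤ (pairings m ^ c * pairings m ^ c) * ∏ T length
solutions∅-bound zero T T-unique = begin
  solutions T ∅ * solutions T ∅ ≡⟨ cong (λ s → s * s) every-choice-solves ⟩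
  ∏ T length * ∏ T length       ≤⟨ *-monoˡ-≤ (∏ T length) (∏≤1 T-unique) ⟩
  1 * ∏ T length                ∎
  where
  open ≤-Reasoning
  every-choice-solves : solutions T ∅ ≡ ∏ T length
  every-choice-solves =
    trans (∑-cong (choices T) (λ w → 𝟙-yes (symDiff w ≐? ∅) (λ ()))) (count-choices T)
  ∏≤1 : ∀ {m} {T : Vec (List (Key 0 σ)) m} → Vec.All Unique T → ∏ T length ≤ 1
  ∏≤1 []                    = s≤s z≤n
  ∏≤1 (L-unique ∷ T-unique) = *-mono-≤ (Unique⇒length≤1 L-unique) (∏≤1 T-unique)
solutions∅-bound {σ = σ} {m = m} (suc c) T T-unique = begin
  solutions T ∅ * solutions T ∅              ≡⟨ cong (λ s → s * s) (solutions∅-by-first-letters T) ⟩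
  evenSum F * evenSum F                      ≤⟨ evenSum-bound m (sliceSizes T) K F F²≤ ⟩
  (D * D) * (K * totalWeight (sliceSizes T)) ≡⟨ cong (λ t → (D * D) * (K * t)) (totalWeight-sliceSizes T) ⟩
  (D * D) * (K * ∏ T length)                 ≡⟨ regroup D (D ^ c) (∏ T length) ⟩
  (D ^ suc c * D ^ suc c) * ∏ T length       ∎
  where
  open ≤-Reasoning
  D K : ℕ
  D = pairings m
  K = D ^ c * D ^ c
  F : Word σ m → ℕ
  F a = solutions (zipWith slice T a) ∅
  regroup : ∀ d e t → (d * d) * ((e * e) * t) ≡ ((d * e) * (d * e)) * t
  regroup = solve-∀
  slices-unique : ∀ {m} {T : Vec (List (Key (suc c) σ)) m} a → Vec.All Unique T →
                  Vec.All Unique (zipWith slice T a)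
  slices-unique []      []                    = []
  slices-unique (b ∷ a) (L-unique ∷ T-unique) = slice-Unique b L-unique ∷ slices-unique a T-unique
  F²≤ : ∀ a → F a * F a ≤ K * weight (sliceSizes T) a
  F²≤ a = ≤-trans (solutions∅-bound c (zipWith slice T a) (slices-unique a T-unique))
                  (≤-reflexive (cong (K *_) (sym (weight-sliceSizes T a))))

_⊕_ : GenKey c σ → GenKey c σ → GenKey c σ
(q ⊕ p) i a = q i a xor p i a

genKeyDecSetoid : ℕ → ℕ → DecSetoid 0ℓ 0ℓ
genKeyDecSetoid c σ = record
  { Carrier          = GenKey c σ
  ; _≈_              = _≐_
  ; isDecEquivalence = record
    { isEquivalence = record
      { refl  = λ _ _ → refl
      ; sym   = λ q≐p i a → sym (q≐p i a)
      ; trans = λ q≐p p≐r i a → trans (q≐p i a) (p≐r i a)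
      }
    ; _≟_ = _≐?_
    }
  }

⊕-cong : ∀ {q q′ : GenKey c σ} p → q ≐ q′ → (q ⊕ p) ≐ (q′ ⊕ p)
⊕-cong p q≐q′ i a = cong (_xor p i a) (q≐q′ i a)

⊕-involutive : ∀ (p q : GenKey c σ) → ((q ⊕ p) ⊕ p) ≐ q
⊕-involutive p q i a = xor-cancelʳ (q i a) (p i a)

⊕-identityʳ : ∀ (q : GenKey c σ) → (q ⊕ ∅) ≐ q
⊕-identityʳ q i a = xor-identityʳ (q i a)

symDiff-++ : ∀ (u : Vec (Key c σ) m) (v : Vec (Key c σ) k) →
             symDiff (u ++ v) ≐ (symDiff u ⊕ symDiff v)
symDiff-++ []      v i a = refl
symDiff-++ (x ∷ u) v i a =
  trans (cong (asSet x i a xor_) (symDiff-++ u v i a)) (sym (xor-assoc (asSet x i a) _ _))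

solutions-replicate-+ : ∀ (S : List (Key c σ)) m k q →
  solutions (replicate (m + k) S) q ≡
  ∑[ x ∈ map symDiff (choices (replicate m S)) ]
  ∑[ y ∈ map symDiff (choices (replicate k S)) ] 𝟙 (x ≐? (y ⊕ q))
solutions-replicate-+ {c} {σ} S m k q = begin
  solutions (replicate (m + k) S) q
    ≡⟨ ∑-choices-replicate-+ S m k _ ⟩
  ∑[ u ∈ U ] ∑[ v ∈ V ] 𝟙 (symDiff (u ++ v) ≐? q)
    ≡⟨ ∑-cong U (λ u → ∑-cong V (λ v →
         𝟙-⇔ (symDiff (u ++ v) ≐? q) (symDiff u ≐? (symDiff v ⊕ q)) (split u v) (merge u v))) ⟩
  ∑[ u ∈ U ] ∑[ v ∈ V ] 𝟙 (symDiff u ≐? (symDiff v ⊕ q))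
    ≡⟨ ∑-cong U (λ u → ∑-map symDiff V _) ⟨
  ∑[ u ∈ U ] ∑[ y ∈ map symDiff V ] 𝟙 (symDiff u ≐? (y ⊕ q))
    ≡⟨ ∑-map symDiff U _ ⟨
  ∑[ x ∈ map symDiff U ] ∑[ y ∈ map symDiff V ] 𝟙 (x ≐? (y ⊕ q)) ∎
  where
  open ≡-Reasoning
  U : List (Vec (Key c σ) m)
  U = choices (replicate m S)
  V : List (Vec (Key c σ) k)
  V = choices (replicate k S)
  split : ∀ (u : Vec _ m) (v : Vec _ k) → symDiff (u ++ v) ≐ q → symDiff u ≐ (symDiff v ⊕ q)
  split u v Δ≐q i a = xor≡⇒≡xor _ _ _ (trans (sym (symDiff-++ u v i a)) (Δ≐q i a))
  merge : ∀ (u : Vec _ m) (v : Vec _ k) → symDiff u ≐ (symDiff v ⊕ q) → symDiff (u ++ v) ≐ q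
  merge u v Δu≐ i a = trans (symDiff-++ u v i a) (≡xor⇒xor≡ _ _ _ (Δu≐ i a))

solutions≤solutions∅ : ∀ (S : List (Key c σ)) t p →
                       solutions (replicate (t + t) S) p ≤ solutions (replicate (t + t) S) ∅
solutions≤solutions∅ {c} {σ} S t p = begin
  solutions (replicate (t + t) S) p
    ≡⟨ solutions-replicate-+ S t t p ⟩
  ∑[ x ∈ L ] ∑[ y ∈ L ] 𝟙 (x ≐? (y ⊕ p))
    ≤⟨ twisted-pairs≤pairs (genKeyDecSetoid c σ) (_⊕ p) (⊕-cong p) (⊕-involutive p) L ⟩
  ∑[ x ∈ L ] ∑[ y ∈ L ] 𝟙 (x ≐? y)
    ≡⟨ ∑-cong L (λ x → ∑-cong L (λ y → 𝟙-⇔ (x ≐? y) (x ≐? (y ⊕ ∅))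
         (λ x≐y i a → trans (x≐y i a) (sym (⊕-identityʳ y i a)))
         (λ x≐y⊕∅ i a → trans (x≐y⊕∅ i a) (⊕-identityʳ y i a)))) ⟩
  ∑[ x ∈ L ] ∑[ y ∈ L ] 𝟙 (x ≐? (y ⊕ ∅))
    ≡⟨ solutions-replicate-+ S t t ∅ ⟨
  solutions (replicate (t + t) S) ∅ ∎
  where
  open ≤-Reasoning
  L : List (GenKey c σ)
  L = map symDiff (choices (replicate t S))

countTuples≡solutions : ∀ (S : List (Key c σ)) p t →
                        countTuples S p t ≡ solutions (replicate (t + t) S) p
countTuples≡solutions S p t = begin
  countTuples S p t
    ≡⟨ length-filter (λ w → symDiff w ≐? p) (tuples S (2 * t)) ⟩
  ∑[ w ∈ tuples S (2 * t) ] 𝟙 (symDiff w ≐? p)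
    ≡⟨ cong (λ W → ∑[ w ∈ W ] 𝟙 (symDiff w ≐? p)) (tuples≡choices S (2 * t)) ⟩
  solutions (replicate (2 * t) S) p
    ≡⟨ cong (λ n → solutions (replicate n S) p) (cong (t +_) (+-identityʳ t)) ⟩
  solutions (replicate (t + t) S) p ∎
  where open ≡-Reasoning

pairings-+-self : ∀ t → pairings (t + t) ≡ dfOdd t
pairings-+-self zero    = refl
pairings-+-self (suc t) = begin
  pairings (suc t + suc t)       ≡⟨ cong (λ n → pairings (suc n)) (+-suc t t) ⟩
  suc (t + t) * pairings (t + t) ≡⟨ cong₂ (λ n d → suc n * d) (cong (t +_) (+-identityʳ t))
                                           (sym (pairings-+-self t)) ⟨
  suc (2 * t) * dfOdd t          ∎
  where open ≡-Reasoning

solutions∅-replicate-bound : ∀ (S : List (Key c σ)) → Unique S → ∀ t →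
  solutions (replicate (t + t) S) ∅ ≤ dfOdd t ^ c * length S ^ t
solutions∅-replicate-bound {c} S S-unique t = m*m≤n*n⇒m≤n _ _ (begin
  solutions (replicate (t + t) S) ∅ * solutions (replicate (t + t) S) ∅
    ≤⟨ solutions∅-bound c (replicate (t + t) S) (copies-unique (t + t)) ⟩
  (pairings (t + t) ^ c * pairings (t + t) ^ c) * ∏ (replicate (t + t) S) length
    ≡⟨ cong₂ (λ d l → (d ^ c * d ^ c) * l) (pairings-+-self t)
             (∏-replicate (t + t) S length) ⟩
  (dfOdd t ^ c * dfOdd t ^ c) * length S ^ (t + t)
    ≡⟨ cong ((dfOdd t ^ c * dfOdd t ^ c) *_) (^-distribˡ-+-* (length S) t t) ⟩
  (dfOdd t ^ c * dfOdd t ^ c) * (length S ^ t * length S ^ t)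
    ≡⟨ interchange (dfOdd t ^ c) (length S ^ t) ⟩
  (dfOdd t ^ c * length S ^ t) * (dfOdd t ^ c * length S ^ t) ∎)
  where
  open ≤-Reasoning
  copies-unique : ∀ m → Vec.All Unique (replicate m S)
  copies-unique zero    = []
  copies-unique (suc m) = S-unique ∷ copies-unique m
  interchange : ∀ a b → (a * a) * (b * b) ≡ (a * b) * (a * b)
  interchange = solve-∀

theorem39 : (c σ : ℕ) (S : List (Key c σ)) → Unique S → (p : GenKey c σ) → (t : ℕ) → 1 ≤ t →
    countTuples S p t ≤ (dfOdd t ^ c) * (length S ^ t)
theorem39 c σ S S-unique p t _ = begin
  countTuples S p t                 ≡⟨ countTuples≡solutions S p t ⟩
  solutions (replicate (t + t) S) p ≤⟨ solutions≤solutions∅ S t p ⟩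
  solutions (replicate (t + t) S) ∅ ≤⟨ solutions∅-replicate-bound S S-unique t ⟩
  dfOdd t ^ c * length S ^ t        ∎
  where open ≤-Reasoning
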